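{- Let $2\le k\le n-1$ be integers and let $W:=\{Y\in\binom{[n]}{k-1}: n\notin Y\}$. Let $X=\{x_1,\dots,x_{k-1}\}\in W$ (with $x_1<\dots<x_{k-1}$) be such that $|V_X|=\max\{|V_Y| : Y\in W,\ \min Y = x_1\}$. Then for every $i=2,\dots,k-1$: (i) if $n-(k-i)x_1+1\ge x_1+i-1$, then $x_i\in\{n-(k-i)x_1,\ n-(k-i)x_1+1\}$; (ii) otherwise, $x_i=x_1+i-1$.
   Context: $[n]=\{1,\dots,n\}$, $\binom{[n]}{r}$ is the set of $r$-subsets of $[n]$, each written with its elements increasing; for $r$-subsets, $X\le Y$ means the increasing tuples compare lexicographically. For $A=\{a_1<\dots<a_k\}\in\binom{[n]}{k}$, $A_s=\{a_1,\dots,a_{k-1}\}$, $A_t=\{a_2,\dots,a_k\}$, and for $X\in\binom{[n]}{k-1}$, $V_X:=\{A\in\binom{[n]}{k}: A_s\le X\le A_t\}$. -}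

module Defs where

open import Data.Nat using (ℕ; zero; suc; _<_; _≡ᵇ_; _<ᵇ_)
open import Data.Bool using (Bool; true; false; _∧_; _∨_)
open import Data.List using (List; []; _∷_; _++_; map; length; filterᵇ; [_])

-- An r-subset of [n] = {1,…,n} is represented by the list of its elements
-- in strictly increasing order.  `subsets n r` enumerates binom([n], r)
-- (each subset exactly once): either n ∉ A, or A = A' ∪ {n} with n the last element.
subsets : ℕ → ℕ → List (List ℕ)
subsets n       zero    = [] ∷ []
subsets zero    (suc r) = []
subsets (suc n) (suc r) = subsets n (suc r) ++ map (λ A → A ++ [ suc n ]) (subsets n r)

lexLeq : List ℕ → List ℕ → Bool
lexLeq []       _        = true
lexLeq (_ ∷ _)  []       = false
lexLeq (x ∷ xs) (y ∷ ys) = (x <ᵇ y) ∨ ((x ≡ᵇ y) ∧ lexLeq xs ys)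

initL : List ℕ → List ℕ
initL []           = []
initL (_ ∷ [])     = []
initL (x ∷ y ∷ xs) = x ∷ initL (y ∷ xs)

tailL : List ℕ → List ℕ
tailL []       = []
tailL (_ ∷ xs) = xs

inVᵇ : List ℕ → List ℕ → Bool
inVᵇ X A = lexLeq (initL A) X ∧ lexLeq X (tailL A)

V : ℕ → ℕ → List ℕ → List (List ℕ)
V n k X = filterᵇ (inVᵇ X) (subsets n k)

cardV : ℕ → ℕ → List ℕ → ℕ
cardV n k X = length (V n k X)

-- i-th element (1-indexed) of an increasing tuple; 0 if out of range
elemAt : List ℕ → ℕ → ℕ
elemAt []       _             = 0
elemAt (x ∷ xs) zero          = 0
elemAt (x ∷ xs) (suc zero)    = x
elemAt (x ∷ xs) (suc (suc i)) = elemAt xs (suc i)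

module Submission where

-- Split A ∈ V_X by its minimum a. Writing X = (x₁, X′) and e = x₁ − 1, each of the e values a < x₁
-- contributes #{B ⊆ (a, n] : X ≤ B}, the value a = x₁ contributes #{B ⊆ (x₁, n] : B_s ≤ X′}, and larger
-- values contribute nothing. Expanding these counts by first elements gives
-- |V_X| = e·C(n − x₁, k − 1) + Φ(X′) with Φ an explicit sum of binomial coefficients C(n − b, ·), so X is
-- a maximiser exactly when X′ maximises Φ. Φ is maximised greedily: if x_i, …, x_{k−1} are L = k − i elements,
-- the best value with x_i = z increases with z while z + 1 + L·x₁ ≤ n and decreases strictly once
-- z + L·x₁ > n, because its increments compare C(M, r + 1) with e·C(M, r), and by absorption
-- (r + 1)·C(M, r + 1) = (M − r)·C(M, r). So every maximiser puts x_i at n − L·x₁ or n − L·x₁ + 1 when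
-- this lies above x_{i−1}, and at x_{i−1} + 1 otherwise.

open import Defs
open import Data.Bool using (Bool; true; false; _∧_; T)
open import Data.Bool.ListAction using (all)
open import Data.Bool.Properties using (∧-zeroʳ; ∧-identityʳ)
open import Data.Empty using (⊥-elim)
open import Data.List using (List; []; _∷_; _++_; _∷ʳ_; map; length; filterᵇ; [_])
open import Data.List.Membership.Propositional using (_∈_; _∉_)
open import Data.List.Membership.Propositional.Properties using (∈-++⁻; ∈-map⁻; ∈-++⁺ˡ; ∈-++⁺ʳ; ∈-map⁺)
open import Data.List.Properties using (length-++)
open import Data.List.Relation.Unary.All using (All; []; _∷_)
import Data.List.Relation.Unary.All as All
open import Data.List.Relation.Unary.All.Properties using (∷ʳ⁺; ∷ʳ⁻)
open import Data.List.Relation.Unary.Any using (here; there)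
open import Data.List.Reverse using (reverseView; []; _∶_∶ʳ_)
open import Data.Nat using (ℕ)
open import Data.Product using (_×_; _,_; proj₁; proj₂)
open import Data.Sum using (_⊎_; inj₁; inj₂)
open import Data.Unit using (⊤; tt)
open import Function using (_∘_; _∘′_)
open import Relation.Nullary using (¬_; yes; no)
open import Relation.Binary.Definitions using (Tri; tri<; tri≈; tri>)
open import Relation.Binary.PropositionalEquality hiding ([_])

module Sums where

  open import Data.Nat
  open import Data.Nat.Properties
  open import Algebra.Properties.CommutativeSemigroup +-commutativeSemigroup using (interchange)

  -- ∑ a d f = f (a + 1) + ⋯ + f (a + d)
  ∑ : ℕ → ℕ → (ℕ → ℕ) → ℕ
  ∑ a zero    f = 0
  ∑ a (suc d) f = f (suc a) + ∑ (suc a) d f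

  ∑-split : ∀ a d₁ d₂ f → ∑ a (d₁ + d₂) f ≡ ∑ a d₁ f + ∑ (a + d₁) d₂ f
  ∑-split a zero     d₂ f rewrite +-identityʳ a = refl
  ∑-split a (suc d₁) d₂ f rewrite ∑-split (suc a) d₁ d₂ f | +-suc a d₁ =
    sym (+-assoc (f (suc a)) (∑ (suc a) d₁ f) _)

  ∑-snoc : ∀ a d f → ∑ a (suc d) f ≡ ∑ a d f + f (suc (a + d))
  ∑-snoc a d f = begin
    ∑ a (suc d) f                  ≡⟨ cong (λ m → ∑ a m f) (+-comm 1 d) ⟩
    ∑ a (d + 1) f                  ≡⟨ ∑-split a d 1 f ⟩
    ∑ a d f + (f (suc (a + d)) + 0) ≡⟨ cong (∑ a d f +_) (+-identityʳ _) ⟩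
    ∑ a d f + f (suc (a + d))      ∎
    where open ≡-Reasoning

  ∑-cong : ∀ a d f g → (∀ s → a < s → s ≤ a + d → f s ≡ g s) → ∑ a d f ≡ ∑ a d g
  ∑-cong a zero    f g h = refl
  ∑-cong a (suc d) f g h rewrite +-suc a d =
    cong₂ _+_ (h (suc a) ≤-refl (s≤s (m≤m+n a d)))
              (∑-cong (suc a) d f g (λ s a<s s≤ → h s (<-trans (n<1+n a) a<s) s≤))

  ∑-+ : ∀ a d f g → ∑ a d (λ s → f s + g s) ≡ ∑ a d f + ∑ a d g
  ∑-+ a zero    f g = refl
  ∑-+ a (suc d) f g rewrite ∑-+ (suc a) d f g =
    interchange (f (suc a)) (g (suc a)) (∑ (suc a) d f) (∑ (suc a) d g)

  ∑-const : ∀ a d c → ∑ a d (λ _ → c) ≡ d * c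
  ∑-const a zero    c = refl
  ∑-const a (suc d) c = cong (c +_) (∑-const (suc a) d c)

  ∑-zero : ∀ a d f → (∀ s → a < s → s ≤ a + d → f s ≡ 0) → ∑ a d f ≡ 0
  ∑-zero a d f h = trans (∑-cong a d f (λ _ → 0) h) (trans (∑-const a d 0) (*-zeroʳ d))

  ∑-split-at : ∀ a z m f → a ≤ z → z < m →
    ∑ a (m ∸ a) f ≡ ∑ a (z ∸ a) f + (f (suc z) + ∑ (suc z) (m ∸ suc z) f)
  ∑-split-at a z m f a≤z z<m = begin
    ∑ a (m ∸ a) f                                 ≡⟨ cong (λ d → ∑ a d f) length-split ⟩
    ∑ a ((z ∸ a) + suc (m ∸ suc z)) f             ≡⟨ ∑-split a (z ∸ a) _ f ⟩
    ∑ a (z ∸ a) f + ∑ (a + (z ∸ a)) (suc (m ∸ suc z)) f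
      ≡⟨ cong (λ b → ∑ a (z ∸ a) f + ∑ b (suc (m ∸ suc z)) f) (m+[n∸m]≡n a≤z) ⟩
    ∑ a (z ∸ a) f + (f (suc z) + ∑ (suc z) (m ∸ suc z) f) ∎
    where
    open ≡-Reasoning
    length-split : m ∸ a ≡ (z ∸ a) + suc (m ∸ suc z)
    length-split = begin
      m ∸ a                       ≡⟨ cong (_∸ a) (sym (m+[n∸m]≡n z<m)) ⟩
      (suc z + (m ∸ suc z)) ∸ a   ≡⟨ +-∸-comm (m ∸ suc z) (m≤n⇒m≤1+n a≤z) ⟩
      (suc z ∸ a) + (m ∸ suc z)   ≡⟨ cong (_+ (m ∸ suc z)) (+-∸-assoc 1 a≤z) ⟩
      suc (z ∸ a) + (m ∸ suc z)   ≡⟨ sym (+-suc (z ∸ a) (m ∸ suc z)) ⟩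
      (z ∸ a) + suc (m ∸ suc z)   ∎

module Binomial where

  open import Data.Nat
  open import Data.Nat.Combinatorics using (_C_; nC1≡n; nCk+nC[k+1]≡[n+1]C[k+1])
  open import Data.Nat.Properties
  open import Data.Nat.Tactic.RingSolver using (solve-∀)
  open Sums

  C-absorption : ∀ M s → suc s * (M C suc s) + s * (M C s) ≡ M * (M C s)
  C-absorption zero    zero    = refl
  C-absorption zero    (suc s) = cong₂ _+_ (*-zeroʳ (suc (suc s))) (*-zeroʳ (suc s))
  C-absorption (suc M) zero    =
    trans (+-identityʳ _) (trans (+-identityʳ _) (trans (nC1≡n (suc M)) (sym (*-identityʳ (suc M)))))
  C-absorption (suc M) (suc s)
    rewrite sym (nCk+nC[k+1]≡[n+1]C[k+1] M (suc s)) | sym (nCk+nC[k+1]≡[n+1]C[k+1] M s) =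
    begin
      suc (suc s) * (c₁ + c₂) + suc s * (c₀ + c₁)
        ≡⟨ regroup s c₀ c₁ c₂ ⟩
      (suc (suc s) * c₂ + suc s * c₁) + (c₁ + c₀ + (suc s * c₁ + s * c₀))
        ≡⟨ cong₂ (λ a b → a + (c₁ + c₀ + b)) (C-absorption M (suc s)) (C-absorption M s) ⟩
      M * c₁ + (c₁ + c₀ + M * c₀)
        ≡⟨ collect M c₀ c₁ ⟩
      suc M * (c₀ + c₁) ∎
    where
    open ≡-Reasoning
    c₀ = M C s
    c₁ = M C suc s
    c₂ = M C suc (suc s)
    regroup : ∀ s c₀ c₁ c₂ → suc (suc s) * (c₁ + c₂) + suc s * (c₀ + c₁)
                           ≡ (suc (suc s) * c₂ + suc s * c₁) + (c₁ + c₀ + (suc s * c₁ + s * c₀))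
    regroup = solve-∀
    collect : ∀ M c₀ c₁ → M * c₁ + (c₁ + c₀ + M * c₀) ≡ suc M * (c₀ + c₁)
    collect = solve-∀

  C-pos : ∀ M s → s ≤ M → 0 < M C s
  C-pos M       zero    _         = z<s
  C-pos (suc M) (suc s) (s≤s s≤M) =
    <-≤-trans (C-pos M s s≤M) (≤-trans (m≤m+n _ _) (≤-reflexive (nCk+nC[k+1]≡[n+1]C[k+1] M s)))

  -- Absorption reads (r + 1)·C(M, r + 1) = (M − r)·C(M, r), so e·C(M, r) compares with
  -- C(M, r + 1) as (r + 1)·e compares with M − r.
  module C-ratio (M r e : ℕ) where

    private
      c₀ = M C r
      c₁ = M C suc r

      scaled : suc r * (e * c₀) + r * c₀ ≡ (suc r * e + r) * c₀
      scaled = identity r e c₀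
        where
        identity : ∀ r e c → suc r * (e * c) + r * c ≡ (suc r * e + r) * c
        identity = solve-∀

    <-case : suc r * e + r < M → e * c₀ < c₁
    <-case T<M = *-cancelˡ-< (suc r) (e * c₀) c₁ (+-cancelʳ-< (r * c₀) _ _ (begin-strict
      suc r * (e * c₀) + r * c₀  ≡⟨ scaled ⟩
      (suc r * e + r) * c₀       <⟨ *-monoˡ-< c₀ {{>-nonZero (C-pos M r r≤M)}} T<M ⟩
      M * c₀                     ≡⟨ sym (C-absorption M r) ⟩
      suc r * c₁ + r * c₀        ∎))
      where
      open ≤-Reasoning
      r≤M : r ≤ M
      r≤M = ≤-trans (m≤n+m r (suc r * e)) (<⇒≤ T<M)

    ≡-case : M ≡ suc r * e + r → e * c₀ ≡ c₁
    ≡-case M≡T = sym (*-cancelˡ-≡ c₁ (e * c₀) (suc r) (+-cancelʳ-≡ (r * c₀) _ _ (begin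
      suc r * c₁ + r * c₀        ≡⟨ C-absorption M r ⟩
      M * c₀                     ≡⟨ cong (_* c₀) M≡T ⟩
      (suc r * e + r) * c₀       ≡⟨ sym scaled ⟩
      suc r * (e * c₀) + r * c₀  ∎)))
      where open ≡-Reasoning

    >-case : M < suc r * e + r → r ≤ M → c₁ < e * c₀
    >-case M<T r≤M = *-cancelˡ-< (suc r) c₁ (e * c₀) (+-cancelʳ-< (r * c₀) _ _ (begin-strict
      suc r * c₁ + r * c₀        ≡⟨ C-absorption M r ⟩
      M * c₀                     <⟨ *-monoˡ-< c₀ {{>-nonZero (C-pos M r r≤M)}} M<T ⟩
      (suc r * e + r) * c₀       ≡⟨ sym scaled ⟩
      suc r * (e * c₀) + r * c₀  ∎))
      where open ≤-Reasoning

  hockey-stick : ∀ n s d t → t + d ≡ n → ∑ t d (λ b → (n ∸ b) C s) ≡ d C suc s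
  hockey-stick n s zero    t _     = refl
  hockey-stick n s (suc d) t t+d≡n =
    trans (cong₂ _+_ (cong (_C s) n∸t≡d) (hockey-stick n s d (suc t) (trans (sym (+-suc t d)) t+d≡n)))
          (nCk+nC[k+1]≡[n+1]C[k+1] d s)
    where
    n∸t≡d : n ∸ suc t ≡ d
    n∸t≡d = trans (cong (_∸ suc t) (trans (sym t+d≡n) (+-suc t d))) (m+n∸m≡n (suc t) d)

module Subsets where

  open import Data.Nat
  open import Data.Nat.Combinatorics using (_C_)
  open import Data.Nat.Properties
  open Sums
  open Binomial

  count : {A : Set} → (A → Bool) → List A → ℕ
  count P xs = length (filterᵇ P xs)

  module _ {A : Set} (P : A → Bool) where

    count-++ : ∀ xs ys → count P (xs ++ ys) ≡ count P xs + count P ys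
    count-++ []       ys = refl
    count-++ (x ∷ xs) ys with P x
    ... | true  = cong suc (count-++ xs ys)
    ... | false = count-++ xs ys

    count-map : {B : Set} (f : B → A) → ∀ xs → count P (map f xs) ≡ count (λ y → P (f y)) xs
    count-map f []       = refl
    count-map f (x ∷ xs) with P (f x)
    ... | true  = cong suc (count-map f xs)
    ... | false = count-map f xs

    count-none : ∀ xs → (∀ x → x ∈ xs → P x ≡ false) → count P xs ≡ 0
    count-none []       _ = refl
    count-none (x ∷ xs) h with P x | h x (here refl)
    ... | false | _ = count-none xs (λ y y∈ → h y (there y∈))

  count-cong : {A : Set} (P Q : A → Bool) → ∀ xs → (∀ x → x ∈ xs → P x ≡ Q x) → count P xs ≡ count Q xs
  count-cong P Q []       _ = refl
  count-cong P Q (x ∷ xs) h with P x | Q x | h x (here refl)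
  ... | true  | true  | _ = cong suc (count-cong P Q xs (λ y y∈ → h y (there y∈)))
  ... | false | false | _ = count-cong P Q xs (λ y y∈ → h y (there y∈))

  <ᵇ-true : ∀ {a b} → a < b → (a <ᵇ b) ≡ true
  <ᵇ-true {zero}  {suc b} _         = refl
  <ᵇ-true {suc a} {suc b} (s≤s a<b) = <ᵇ-true a<b

  <ᵇ-false : ∀ {a b} → b ≤ a → (a <ᵇ b) ≡ false
  <ᵇ-false {a}     {zero}  _         = refl
  <ᵇ-false {suc a} {suc b} (s≤s b≤a) = <ᵇ-false b≤a

  ≡ᵇ-refl : ∀ a → (a ≡ᵇ a) ≡ true
  ≡ᵇ-refl zero    = refl
  ≡ᵇ-refl (suc a) = ≡ᵇ-refl a

  ≡ᵇ-false : ∀ {a b} → a ≢ b → (a ≡ᵇ b) ≡ false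
  ≡ᵇ-false {zero}  {zero}  a≢b = ⊥-elim (a≢b refl)
  ≡ᵇ-false {zero}  {suc b} _   = refl
  ≡ᵇ-false {suc a} {zero}  _   = refl
  ≡ᵇ-false {suc a} {suc b} a≢b = ≡ᵇ-false (a≢b ∘′ cong suc)

  Ascending : ℕ → List ℕ → Set
  Ascending p []      = ⊤
  Ascending p (z ∷ Z) = p < z × Ascending z Z

  Ascending-∷ʳ⁺ : ∀ {p y} ys → Ascending p ys → All (_< y) ys → p < y → Ascending p (ys ∷ʳ y)
  Ascending-∷ʳ⁺ []       _           []            p<y = p<y , tt
  Ascending-∷ʳ⁺ (z ∷ zs) (p<z , asc) (z<y ∷ zs<y) _   = p<z , Ascending-∷ʳ⁺ zs asc zs<y z<y

  Ascending-∷ʳ⁻ : ∀ {p y} ys → Ascending p (ys ∷ʳ y) → Ascending p ys × All (_< y) ys × p < y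
  Ascending-∷ʳ⁻ []       (p<y , _)   = tt , [] , p<y
  Ascending-∷ʳ⁻ (z ∷ zs) (p<z , asc) with Ascending-∷ʳ⁻ zs asc
  ... | asc′ , zs<y , z<y = (p<z , asc′) , z<y ∷ zs<y , <-trans p<z z<y

  Ascending-weaken : ∀ {p q} Z → p ≤ q → Ascending q Z → Ascending p Z
  Ascending-weaken []      _   _           = tt
  Ascending-weaken (z ∷ Z) p≤q (q<z , asc) = ≤-<-trans p≤q q<z , asc

  length-∷ʳ : ∀ (ys : List ℕ) y → length (ys ∷ʳ y) ≡ suc (length ys)
  length-∷ʳ ys y = trans (length-++ ys) (+-comm (length ys) 1)

  ∈-subsets⁻ : ∀ n r B → B ∈ subsets n r → length B ≡ r × Ascending 0 B × All (_≤ n) B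
  ∈-subsets⁻ n       zero    .[] (here refl) = refl , tt , []
  ∈-subsets⁻ (suc n) (suc r) B   B∈ with ∈-++⁻ (subsets n (suc r)) B∈
  ... | inj₁ B∈′ with ∈-subsets⁻ n (suc r) B B∈′
  ...   | len , asc , B≤n = len , asc , All.map (m≤n⇒m≤1+n) B≤n
  ∈-subsets⁻ (suc n) (suc r) B   B∈ | inj₂ B∈′ with ∈-map⁻ (_∷ʳ suc n) B∈′
  ... | B′ , B′∈ , refl with ∈-subsets⁻ n r B′ B′∈
  ...   | len , asc , B′≤n =
    trans (length-∷ʳ B′ (suc n)) (cong suc len) ,
    Ascending-∷ʳ⁺ B′ asc (All.map s≤s B′≤n) z<s ,
    ∷ʳ⁺ (All.map m≤n⇒m≤1+n B′≤n) ≤-refl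

  ∈-subsets⁺ : ∀ n Y → Ascending 0 Y → All (_≤ n) Y → Y ∈ subsets n (length Y)
  ∈-subsets⁺ n Y asc Y≤n with reverseView Y
  ∈-subsets⁺ n       .[]        _   _   | [] = here refl
  ∈-subsets⁺ zero    .(ys ∷ʳ y) asc Y≤n | ys ∶ _ ∶ʳ y =
    ⊥-elim (<⇒≱ (proj₂ (proj₂ (Ascending-∷ʳ⁻ ys asc))) (proj₂ (∷ʳ⁻ Y≤n)))
  ∈-subsets⁺ (suc m) .(ys ∷ʳ y) asc Y≤n | ys ∶ _ ∶ʳ y =
    subst (λ l → ys ∷ʳ y ∈ subsets (suc m) l) (sym (length-∷ʳ ys y))
          (by-top (m≤n⇒m<n∨m≡n (proj₂ (∷ʳ⁻ Y≤n))))
    where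
    ys<y = proj₁ (proj₂ (Ascending-∷ʳ⁻ ys asc))
    by-top : y < suc m ⊎ y ≡ suc m → ys ∷ʳ y ∈ subsets (suc m) (suc (length ys))
    by-top (inj₁ y≤m) = ∈-++⁺ˡ (subst (λ l → ys ∷ʳ y ∈ subsets m l) (length-∷ʳ ys y)
      (∈-subsets⁺ m (ys ∷ʳ y) asc
        (∷ʳ⁺ (All.map (λ x<y → <⇒≤ (<-≤-trans x<y (≤-pred y≤m))) ys<y) (≤-pred y≤m))))
    by-top (inj₂ refl) = ∈-++⁺ʳ (subsets m (suc (length ys)))
      (∈-map⁺ (_∷ʳ suc m) (∈-subsets⁺ m ys (proj₁ (Ascending-∷ʳ⁻ ys asc)) (All.map ≤-pred ys<y)))

  countAbove : ℕ → ℕ → ℕ → (List ℕ → Bool) → ℕ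
  countAbove n t r Q = count (λ B → all (t <ᵇ_) B ∧ Q B) (subsets n r)

  all-<ᵇ-∷ʳ : ∀ {s m} B → s < m → all (s <ᵇ_) (B ∷ʳ m) ≡ all (s <ᵇ_) B
  all-<ᵇ-∷ʳ []      s<m = cong (_∧ true) (<ᵇ-true s<m)
  all-<ᵇ-∷ʳ (b ∷ B) s<m = cong (_ ∧_) (all-<ᵇ-∷ʳ B s<m)

  all-<ᵇ-weaken : ∀ {t s} B → t < s → all (s <ᵇ_) B ≡ true → all (t <ᵇ_) B ≡ true
  all-<ᵇ-weaken         []      _   _ = refl
  all-<ᵇ-weaken {t} {s} (b ∷ B) t<s h with s <ᵇ b in s<ᵇb | all (s <ᵇ_) B in rest
  all-<ᵇ-weaken {t} {s} (b ∷ B) t<s refl | true | true =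
    cong₂ _∧_ (<ᵇ-true (<-trans t<s (<ᵇ⇒< s b (subst T (sym s<ᵇb) _)))) (all-<ᵇ-weaken B t<s rest)

  countAbove-cong : ∀ n t r Q₁ Q₂ → (∀ B → length B ≡ r → all (t <ᵇ_) B ≡ true → Q₁ B ≡ Q₂ B) →
    countAbove n t r Q₁ ≡ countAbove n t r Q₂
  countAbove-cong n t r Q₁ Q₂ h = count-cong _ _ (subsets n r) pointwise
    where
    pointwise : ∀ B → B ∈ subsets n r → (all (t <ᵇ_) B ∧ Q₁ B) ≡ (all (t <ᵇ_) B ∧ Q₂ B)
    pointwise B B∈ with all (t <ᵇ_) B in above
    ... | false = refl
    ... | true  = h B (proj₁ (∈-subsets⁻ n r B B∈)) above

  countAbove-none : ∀ n t r Q → (∀ B → length B ≡ r → all (t <ᵇ_) B ≡ true → Q B ≡ false) →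
    countAbove n t r Q ≡ 0
  countAbove-none n t r Q h =
    trans (countAbove-cong n t r Q (λ _ → false) h)
          (count-none _ (subsets n r) (λ B _ → ∧-zeroʳ (all (t <ᵇ_) B)))

  countAbove-suc : ∀ n t r Q → t ≤ n →
    countAbove (suc n) t (suc r) Q ≡ countAbove n t (suc r) Q + countAbove n t r (λ B → Q (B ∷ʳ suc n))
  countAbove-suc n t r Q t≤n =
    trans (count-++ _ (subsets n (suc r)) _)
          (cong (countAbove n t (suc r) Q +_)
            (trans (count-map _ _ (subsets n r))
                   (count-cong _ _ (subsets n r) (λ B _ → cong (_∧ Q (B ∷ʳ suc n)) (all-<ᵇ-∷ʳ B (s≤s t≤n))))))

  countAbove-top : ∀ n r Q → countAbove (suc n) (suc n) (suc r) Q ≡ 0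
  countAbove-top n r Q = count-none _ (subsets (suc n) (suc r)) none
    where
    none : ∀ B → B ∈ subsets (suc n) (suc r) → (all (suc n <ᵇ_) B ∧ Q B) ≡ false
    none B B∈ with ∈-subsets⁻ (suc n) (suc r) B B∈
    none (b ∷ B) B∈ | _ , _ , b≤n ∷ _ rewrite <ᵇ-false {suc n} {b} b≤n = refl

  count-subsets-by-min : ∀ n r P → count P (subsets n (suc r)) ≡ ∑ 0 n (λ s → countAbove n s r (λ B → P (s ∷ B)))
  count-subsets-by-min zero    r       P = refl
  count-subsets-by-min (suc n) zero    P =
    trans (count-++ P (subsets n 1) _)
          (trans (cong₂ _+_ (count-subsets-by-min n zero P) top)
                 (sym (∑-snoc 0 n (λ s → countAbove (suc n) s zero (λ B → P (s ∷ B))))))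
    where
    top : count P [ [ suc n ] ] ≡ countAbove (suc n) (suc n) zero (λ B → P (suc n ∷ B))
    top with P [ suc n ]
    ... | true  = refl
    ... | false = refl
  count-subsets-by-min (suc n) (suc r) P = begin
    count P (subsets n (suc (suc r)) ++ map (_∷ʳ suc n) (subsets n (suc r)))
      ≡⟨ count-++ P (subsets n (suc (suc r))) _ ⟩
    count P (subsets n (suc (suc r))) + count P (map (_∷ʳ suc n) (subsets n (suc r)))
      ≡⟨ cong₂ _+_ (count-subsets-by-min n (suc r) P)
                   (trans (count-map P (_∷ʳ suc n) (subsets n (suc r))) (count-subsets-by-min n r (λ B → P (B ∷ʳ suc n)))) ⟩
    ∑ 0 n (λ s → countAbove n s (suc r) (P ∘ (s ∷_))) + ∑ 0 n (λ s → countAbove n s r (λ B → P (s ∷ B ∷ʳ suc n)))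
      ≡⟨ sym (∑-+ 0 n _ _) ⟩
    ∑ 0 n (λ s → countAbove n s (suc r) (P ∘ (s ∷_)) + countAbove n s r (λ B → P (s ∷ B ∷ʳ suc n)))
      ≡⟨ ∑-cong 0 n _ _ (λ s _ s≤n → sym (countAbove-suc n s r (P ∘ (s ∷_)) s≤n)) ⟩
    ∑ 0 n (λ s → countAbove (suc n) s (suc r) (P ∘ (s ∷_)))
      ≡⟨ sym (+-identityʳ _) ⟩
    ∑ 0 n (λ s → countAbove (suc n) s (suc r) (P ∘ (s ∷_))) + 0
      ≡⟨ cong (∑ 0 n (λ s → countAbove (suc n) s (suc r) (P ∘ (s ∷_))) +_) (sym (countAbove-top n r _)) ⟩
    ∑ 0 n (λ s → countAbove (suc n) s (suc r) (P ∘ (s ∷_))) + countAbove (suc n) (suc n) (suc r) (P ∘ (suc n ∷_))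
      ≡⟨ sym (∑-snoc 0 n _) ⟩
    ∑ 0 (suc n) (λ s → countAbove (suc n) s (suc r) (P ∘ (s ∷_))) ∎
    where open ≡-Reasoning

  countAbove-by-min : ∀ n t r Q → t ≤ n →
    countAbove n t (suc r) Q ≡ ∑ t (n ∸ t) (λ s → countAbove n s r (λ B → Q (s ∷ B)))
  countAbove-by-min n t r Q t≤n = begin
    countAbove n t (suc r) Q                 ≡⟨ count-subsets-by-min n r _ ⟩
    ∑ 0 n f                                  ≡⟨ cong (λ m → ∑ 0 m f) (sym (m+[n∸m]≡n t≤n)) ⟩
    ∑ 0 (t + (n ∸ t)) f                      ≡⟨ ∑-split 0 t (n ∸ t) f ⟩
    ∑ 0 t f + ∑ t (n ∸ t) f                  ≡⟨ cong₂ _+_ (∑-zero 0 t f below) (∑-cong t (n ∸ t) f _ above) ⟩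
    ∑ t (n ∸ t) (λ s → countAbove n s r (λ B → Q (s ∷ B))) ∎
    where
    open ≡-Reasoning
    f : ℕ → ℕ
    f s = countAbove n s r (λ B → all (t <ᵇ_) (s ∷ B) ∧ Q (s ∷ B))
    below : ∀ s → 0 < s → s ≤ t → f s ≡ 0
    below s _ s≤t rewrite <ᵇ-false {t} {s} s≤t =
      count-none _ (subsets n r) (λ B _ → ∧-zeroʳ (all (s <ᵇ_) B))
    above : ∀ s → t < s → s ≤ t + (n ∸ t) → f s ≡ countAbove n s r (λ B → Q (s ∷ B))
    above s t<s _ rewrite <ᵇ-true t<s =
      countAbove-cong n s r _ _ (λ B _ s<B → cong (_∧ Q (s ∷ B)) (all-<ᵇ-weaken B t<s s<B))

  countAbove-true : ∀ n t s → t ≤ n → countAbove n t s (λ _ → true) ≡ (n ∸ t) C s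
  countAbove-true n t zero    t≤n = refl
  countAbove-true n t (suc s) t≤n =
    trans (countAbove-by-min n t s _ t≤n)
          (trans (∑-cong t (n ∸ t) _ _ (λ b _ b≤ → countAbove-true n b s (≤-trans b≤ (≤-reflexive (m+[n∸m]≡n t≤n)))))
                 (hockey-stick n s (n ∸ t) t (m+[n∸m]≡n t≤n)))

module Decomposition (n : ℕ) where

  open import Data.Nat
  open import Data.Nat.Combinatorics using (_C_)
  open import Data.Nat.Properties
  open import Data.Nat.Tactic.RingSolver using (solve-∀)
  open Sums
  open Subsets

  N : ℕ → ℕ → ℕ
  N t s = (n ∸ t) C s

  upper : ℕ → List ℕ → ℕ
  upper p Z = countAbove n p (length Z) (lexLeq Z)

  lower : ℕ → List ℕ → ℕ
  lower p Z = countAbove n p (suc (length Z)) (λ B → lexLeq (initL B) Z)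

  ∑-N : ∀ z s → z ≤ n → ∑ z (n ∸ z) (λ b → countAbove n b s (λ _ → true)) ≡ N z (suc s)
  ∑-N z s z≤ = trans (sym (countAbove-by-min n z s _ z≤)) (countAbove-true n z (suc s) z≤)

  upper-∷ : ∀ p z Z → p < z → z ≤ n → upper p (z ∷ Z) ≡ N z (suc (length Z)) + upper z Z
  upper-∷ p (suc z) Z (s≤s p≤z) z<n = begin
    upper p (suc z ∷ Z)                                ≡⟨ countAbove-by-min n p (length Z) _ p≤n ⟩
    ∑ p (n ∸ p) f                                      ≡⟨ ∑-split-at p z n f p≤z z<n ⟩
    ∑ p (z ∸ p) f + (f (suc z) + ∑ (suc z) (n ∸ suc z) f)
      ≡⟨ cong₂ _+_ (∑-zero p (z ∸ p) f below)
                   (cong₂ _+_ f-at-z (trans (∑-cong (suc z) (n ∸ suc z) f _ above) (∑-N (suc z) (length Z) z<n))) ⟩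
    upper (suc z) Z + N (suc z) (suc (length Z))       ≡⟨ +-comm (upper (suc z) Z) _ ⟩
    N (suc z) (suc (length Z)) + upper (suc z) Z       ∎
    where
    open ≡-Reasoning
    p≤n = ≤-trans p≤z (<⇒≤ z<n)
    f : ℕ → ℕ
    f b = countAbove n b (length Z) (λ B → lexLeq (suc z ∷ Z) (b ∷ B))
    below : ∀ b → p < b → b ≤ p + (z ∸ p) → f b ≡ 0
    below b _ b≤ rewrite m+[n∸m]≡n p≤z
                       | <ᵇ-false {suc z} {b} (m≤n⇒m≤1+n b≤)
                       | ≡ᵇ-false {suc z} {b} (λ z≡b → <⇒≱ (s≤s b≤) (≤-reflexive z≡b))
      = countAbove-none n b (length Z) _ (λ _ _ _ → refl)
    above : ∀ b → suc z < b → b ≤ suc z + (n ∸ suc z) → f b ≡ countAbove n b (length Z) (λ _ → true)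
    above b z<b _ rewrite <ᵇ-true z<b = refl
    f-at-z : f (suc z) ≡ upper (suc z) Z
    f-at-z rewrite <ᵇ-false {suc z} {suc z} ≤-refl | ≡ᵇ-refl z = refl

  lower-[] : ∀ p → p ≤ n → lower p [] ≡ N p 1
  lower-[] p p≤n = trans (countAbove-cong n p 1 _ (λ _ → true) singleton) (countAbove-true n p 1 p≤n)
    where
    singleton : ∀ B → length B ≡ 1 → all (p <ᵇ_) B ≡ true → lexLeq (initL B) [] ≡ true
    singleton (c ∷ []) _ _ = refl

  lower-∷ : ∀ p z Z → p < z → z ≤ n →
    lower p (z ∷ Z) ≡ ∑ p (z ∸ suc p) (λ b → N b (suc (length Z))) + lower z Z
  lower-∷ p (suc z) Z (s≤s p≤z) z<n = begin
    lower p (suc z ∷ Z)         ≡⟨ countAbove-by-min n p (suc (length Z)) _ p≤n ⟩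
    ∑ p (n ∸ p) f₀
      ≡⟨ ∑-cong p (n ∸ p) f₀ f (λ b _ _ → countAbove-cong n b (suc (length Z)) _ _ init-∷) ⟩
    ∑ p (n ∸ p) f               ≡⟨ ∑-split-at p z n f p≤z z<n ⟩
    ∑ p (z ∸ p) f + (f (suc z) + ∑ (suc z) (n ∸ suc z) f)
      ≡⟨ cong₂ _+_ (∑-cong p (z ∸ p) f _ below)
                   (trans (cong₂ _+_ f-at-z (∑-zero (suc z) (n ∸ suc z) f above)) (+-identityʳ _)) ⟩
    ∑ p (z ∸ p) (λ b → N b (suc (length Z))) + lower (suc z) Z ∎
    where
    open ≡-Reasoning
    p≤n = ≤-trans p≤z (<⇒≤ z<n)
    f₀ f : ℕ → ℕ
    f₀ b = countAbove n b (suc (length Z)) (λ B → lexLeq (initL (b ∷ B)) (suc z ∷ Z))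
    f  b = countAbove n b (suc (length Z)) (λ B → lexLeq (b ∷ initL B) (suc z ∷ Z))
    init-∷ : ∀ {b} B → length B ≡ suc (length Z) → all (b <ᵇ_) B ≡ true →
      lexLeq (initL (b ∷ B)) (suc z ∷ Z) ≡ lexLeq (b ∷ initL B) (suc z ∷ Z)
    init-∷ (c ∷ C) _ _ = refl
    below : ∀ b → p < b → b ≤ p + (z ∸ p) → f b ≡ N b (suc (length Z))
    below b _ b≤ rewrite m+[n∸m]≡n p≤z | <ᵇ-true {b} {suc z} (s≤s b≤) =
      countAbove-true n b (suc (length Z)) (≤-trans (m≤n⇒m≤1+n b≤) z<n)
    above : ∀ b → suc z < b → b ≤ suc z + (n ∸ suc z) → f b ≡ 0
    above b z<b _ rewrite <ᵇ-false {b} {suc z} (<⇒≤ z<b) | ≡ᵇ-false {b} {suc z} (≢-sym (<⇒≢ z<b)) =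
      countAbove-none n b (suc (length Z)) _ (λ _ _ _ → refl)
    f-at-z : f (suc z) ≡ lower (suc z) Z
    f-at-z rewrite <ᵇ-false {suc z} {suc z} ≤-refl | ≡ᵇ-refl z = refl

  module _ (e : ℕ) where

    Φ : ℕ → List ℕ → ℕ
    Φ p []      = N p 1 + e
    Φ p (z ∷ Z) = ∑ p (z ∸ suc p) (λ b → N b (suc (length Z))) + e * N z (suc (length Z)) + Φ z Z

    lower+e*upper≡Φ : ∀ p Z → p ≤ n → Ascending p Z → All (_≤ n) Z → lower p Z + e * upper p Z ≡ Φ p Z
    lower+e*upper≡Φ p []      p≤n _           _ rewrite lower-[] p p≤n | *-identityʳ e = refl
    lower+e*upper≡Φ p (z ∷ Z) p≤n (p<z , asc) (z≤ ∷ Z≤)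
      rewrite lower-∷ p z Z p<z z≤ | upper-∷ p z Z p<z z≤ | sym (lower+e*upper≡Φ z Z z≤ asc Z≤) =
      regroup e (∑ p (z ∸ suc p) (λ b → N b (suc (length Z)))) (lower z Z) (N z (suc (length Z))) (upper z Z)
      where
      regroup : ∀ e a b c d → a + b + e * (c + d) ≡ a + e * c + (b + e * d)
      regroup = solve-∀

    cardV-decomposition : ∀ r X′ → length X′ ≡ r → Ascending (suc e) X′ → suc e ≤ n → All (_≤ n) X′ →
      cardV n (suc (suc r)) (suc e ∷ X′) ≡ e * N (suc e) (suc r) + Φ (suc e) X′
    cardV-decomposition r X′ refl asc x₁≤ X′≤ = begin
      cardV n (suc (suc r)) X                        ≡⟨ count-subsets-by-min n (suc r) (inVᵇ X) ⟩
      ∑ 0 n f                                        ≡⟨ ∑-split-at 0 e n f z≤n x₁≤ ⟩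
      ∑ 0 e f + (f (suc e) + ∑ (suc e) (n ∸ suc e) f)
        ≡⟨ cong₂ _+_ (trans (∑-cong 0 e f _ below) (∑-const 0 e _))
                     (cong₂ _+_ at-x₁ (∑-zero (suc e) (n ∸ suc e) f above)) ⟩
      e * (N (suc e) (suc r) + upper (suc e) X′) + (lower (suc e) X′ + 0)
        ≡⟨ regroup e (N (suc e) (suc r)) (upper (suc e) X′) (lower (suc e) X′) ⟩
      e * N (suc e) (suc r) + (lower (suc e) X′ + e * upper (suc e) X′)
        ≡⟨ cong (e * N (suc e) (suc r) +_) (lower+e*upper≡Φ (suc e) X′ x₁≤ asc X′≤) ⟩
      e * N (suc e) (suc r) + Φ (suc e) X′           ∎
      where
      open ≡-Reasoning
      X = suc e ∷ X′
      regroup : ∀ e a b c → e * (a + b) + (c + 0) ≡ e * a + (c + e * b)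
      regroup = solve-∀
      f : ℕ → ℕ
      f a = countAbove n a (suc r) (λ B → inVᵇ X (a ∷ B))
      below : ∀ a → 0 < a → a ≤ 0 + e → f a ≡ N (suc e) (suc r) + upper (suc e) X′
      below a _ a≤e = trans (countAbove-cong n a (suc r) _ (lexLeq X) A∈V) (upper-∷ a (suc e) X′ (s≤s a≤e) x₁≤)
        where
        A∈V : ∀ B → length B ≡ suc r → all (a <ᵇ_) B ≡ true → inVᵇ X (a ∷ B) ≡ lexLeq X B
        A∈V (c ∷ C) _ _ rewrite <ᵇ-true {a} {suc e} (s≤s a≤e) = refl
      at-x₁ : f (suc e) ≡ lower (suc e) X′
      at-x₁ = countAbove-cong n (suc e) (suc r) _ _ A∈V
        where
        A∈V : ∀ B → length B ≡ suc r → all (suc e <ᵇ_) B ≡ true → inVᵇ X (suc e ∷ B) ≡ lexLeq (initL B) X′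
        A∈V (c ∷ C) _ x₁<B with suc e <ᵇ c in x₁<c
        A∈V (c ∷ C) _ () | false
        ... | true rewrite <ᵇ-false {suc e} {suc e} ≤-refl | ≡ᵇ-refl e = ∧-identityʳ _
      above : ∀ a → suc e < a → a ≤ suc e + (n ∸ suc e) → f a ≡ 0
      above a x₁<a _ = countAbove-none n a (suc r) _ A∉V
        where
        A∉V : ∀ B → length B ≡ suc r → all (a <ᵇ_) B ≡ true → inVᵇ X (a ∷ B) ≡ false
        A∉V (c ∷ C) _ _
          rewrite <ᵇ-false {a} {suc e} (<⇒≤ x₁<a) | ≡ᵇ-false {a} {suc e} (≢-sym (<⇒≢ x₁<a)) = refl

module Monotone (g : ℕ → ℕ) where

  open import Data.Nat
  open import Data.Nat.Properties

  <-chain : ∀ {a b} → (∀ y → a ≤ y → y < b → g y < g (suc y)) → a < b → g a < g b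
  <-chain {a} {suc b} step (s≤s a≤b) with m≤n⇒m<n∨m≡n a≤b
  ... | inj₁ a<b  = <-trans (<-chain (λ y a≤y y<b → step y a≤y (m<n⇒m<1+n y<b)) a<b) (step b a≤b ≤-refl)
  ... | inj₂ refl = step a ≤-refl ≤-refl

  >-chain : ∀ {a b} → (∀ y → a ≤ y → y < b → g (suc y) < g y) → a < b → g b < g a
  >-chain {a} {suc b} step (s≤s a≤b) with m≤n⇒m<n∨m≡n a≤b
  ... | inj₁ a<b  = <-trans (step b a≤b ≤-refl) (>-chain (λ y a≤y y<b → step y a≤y (m<n⇒m<1+n y<b)) a<b)
  ... | inj₂ refl = step a ≤-refl ≤-refl

module Maximisation (n e : ℕ) where

  open import Data.Nat
  open import Data.Nat.Combinatorics using (nCk+nC[k+1]≡[n+1]C[k+1])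
  open import Data.Nat.Properties
  open import Data.Nat.Tactic.RingSolver using (solve-∀)
  open Sums
  open Subsets
  open Binomial
  open Monotone
  open Decomposition n

  x₁ : ℕ
  x₁ = suc e

  Admissible : ℕ → List ℕ → Set
  Admissible p Z = Ascending p Z × All (_< n) Z

  -- the greedy position n − L·x₁ for the first of L remaining elements lies above p
  Fits : ℕ → ℕ → Set
  Fits p L = suc p + L * x₁ ≤ n

  choice : ℕ → ℕ → ℕ
  choice p L with suc p + L * x₁ ≤? n
  ... | yes _ = n ∸ L * x₁
  ... | no  _ = suc p

  greedy : ℕ → ℕ → List ℕ
  greedy p zero    = []
  greedy p (suc r) = choice p (suc r) ∷ greedy (choice p (suc r)) r

  Placed : ℕ → ℕ → ℕ → Set
  Placed b c v = (b + c ≤ n × (v + c ≡ n ⊎ v + c ≡ suc n)) ⊎ (¬ (b + c ≤ n) × v ≡ b)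

  Allowed : ℕ → ℕ → ℕ → Set
  Allowed p L z = Placed (suc p) (L * x₁) z

  Greedy : ℕ → List ℕ → Set
  Greedy p []      = ⊤
  Greedy p (z ∷ Z) = Allowed p (suc (length Z)) z × Greedy z Z

  length-greedy : ∀ p r → length (greedy p r) ≡ r
  length-greedy p zero    = refl
  length-greedy p (suc r) = cong suc (length-greedy _ r)

  choice-spec : ∀ p L → (Fits p L × choice p L ≡ n ∸ L * x₁) ⊎ (¬ Fits p L × choice p L ≡ suc p)
  choice-spec p L with suc p + L * x₁ ≤? n
  ... | yes fits = inj₁ (fits , refl)
  ... | no ¬fits = inj₂ (¬fits , refl)

  L≤L*x₁ : ∀ L → L ≤ L * x₁
  L≤L*x₁ L = m≤m*n L x₁

  choice-bounds : ∀ p r → p + suc r < n → p < choice p (suc r) × choice p (suc r) + r < n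
  choice-bounds p r room with choice-spec p (suc r)
  ... | inj₁ (fits , eq) rewrite eq =
    m+n≤o⇒m≤o∸n (suc p) fits ,
    subst (n ∸ suc r * x₁ + r <_) (m∸n+n≡m (m+n≤o⇒n≤o (suc p) fits))
          (+-monoʳ-< (n ∸ suc r * x₁) (L≤L*x₁ (suc r)))
  ... | inj₂ (_ , eq) rewrite eq = ≤-refl , subst (_< n) (+-suc p r) room

  greedy-admissible : ∀ r p → p + r < n → Admissible p (greedy p r)
  greedy-admissible zero    p _    = tt , []
  greedy-admissible (suc r) p room with choice-bounds p r room
  ... | p<c , c+r<n with greedy-admissible r (choice p (suc r)) c+r<n
  ...   | asc , <n = (p<c , asc) , m+n≤o⇒m≤o (suc (choice p (suc r))) c+r<n ∷ <n

  admissible-room : ∀ z Z → z < n → Admissible z Z → z + length Z < n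
  admissible-room z []      z<n _ = subst (_< n) (sym (+-identityʳ z)) z<n
  admissible-room z (w ∷ W) _   ((z<w , asc) , w<n ∷ W<n) =
    subst (_< n) (sym (+-suc z (length W))) (≤-<-trans (+-monoˡ-≤ (length W) z<w) (admissible-room w W w<n (asc , W<n)))

  N-pascal : ∀ z s → z < n → N z (suc s) ≡ N (suc z) s + N (suc z) (suc s)
  N-pascal z s z<n rewrite +-∸-assoc 1 z<n = sym (nCk+nC[k+1]≡[n+1]C[k+1] (n ∸ suc z) s)

  Φ-∷ : ∀ p z Z r → length Z ≡ r →
    Φ e p (z ∷ Z) ≡ ∑ p (z ∸ suc p) (λ b → N b (suc r)) + e * N z (suc r) + Φ e z Z
  Φ-∷ p z Z r refl = refl

  Φ-shift : ∀ z w W → suc z < w → Φ e z (w ∷ W) ≡ N (suc z) (suc (length W)) + Φ e (suc z) (w ∷ W)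
  Φ-shift z w W z<w rewrite +-∸-assoc 1 z<w =
    regroup (N (suc z) (suc (length W))) (∑ (suc z) (w ∸ suc (suc z)) (λ b → N b (suc (length W))))
            (e * N w (suc (length W))) (Φ e w W)
    where
    regroup : ∀ a b c d → a + b + c + d ≡ a + (b + c + d)
    regroup = solve-∀

  best : ℕ → ℕ → ℕ
  best z r = Φ e z (greedy z r)

  GreedyIsMax : ℕ → Set
  GreedyIsMax r = ∀ p Z → length Z ≡ r → Admissible p Z → Φ e p Z ≤ best p r

  MaxIsGreedy : ℕ → Set
  MaxIsGreedy r = ∀ p Z → length Z ≡ r → Admissible p Z → best p r ≤ Φ e p Z → Greedy p Z

  best-zero : ∀ z → z < n → best (suc z) 0 + N (suc z) 0 ≡ best z 0
  best-zero z z<n rewrite N-pascal z 0 z<n = regroup (N (suc z) 1) e (N (suc z) 0)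
    where
    regroup : ∀ a e b → a + e + b ≡ b + a + e
    regroup = solve-∀

  best-shift : ∀ r z → suc z + suc r < n → best (suc z) (suc r) + N (suc z) (suc r) ≡ Φ e z (greedy (suc z) (suc r))
  best-shift r z room with greedy-admissible (suc r) (suc z) room
  ... | (z<w , _) , _ = begin
    Φ e (suc z) (w ∷ ws) + N (suc z) (suc r)           ≡⟨ +-comm (Φ e (suc z) (w ∷ ws)) _ ⟩
    N (suc z) (suc r) + Φ e (suc z) (w ∷ ws)
      ≡⟨ cong (λ l → N (suc z) (suc l) + Φ e (suc z) (w ∷ ws)) (sym (length-greedy w r)) ⟩
    N (suc z) (suc (length ws)) + Φ e (suc z) (w ∷ ws) ≡⟨ sym (Φ-shift z w ws z<w) ⟩
    Φ e z (w ∷ ws)                                      ∎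
    where
    open ≡-Reasoning
    w  = choice (suc z) (suc r)
    ws = greedy w r

  -- greedy (suc z) r is itself a candidate above z.
  best-step : ∀ r → GreedyIsMax r → ∀ z → suc z + r < n → best (suc z) r + N (suc z) r ≤ best z r
  best-step zero    _  z room = ≤-reflexive (best-zero z (≤-trans (m≤m+n (suc z) 0) (<⇒≤ room)))
  best-step (suc r) ih z room =
    ≤-trans (≤-reflexive (best-shift r z room))
            (ih z _ (length-greedy (suc z) (suc r)) (Ascending-weaken _ (n≤1+n z) asc , <n))
    where
    adm = greedy-admissible (suc r) (suc z) room
    asc = proj₁ adm
    <n  = proj₂ adm

  choice-shift : ∀ z L → Fits z (suc L) → choice z L ≡ choice (suc z) L
  choice-shift z L fits with choice-spec z L | choice-spec (suc z) L
  ... | inj₁ (_ , c≡) | inj₁ (_ , c′≡) = trans c≡ (sym c′≡)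
  ... | inj₂ (¬fits , _) | _ = ⊥-elim (¬fits (≤-trans (+-monoʳ-≤ (suc z) (m≤n+m (L * x₁) x₁)) fits))
  ... | _ | inj₂ (¬fits , _) = ⊥-elim (¬fits (≤-trans shift fits))
    where
    shift : suc (suc z) + L * x₁ ≤ suc z + suc L * x₁
    shift = ≤-trans (≤-reflexive (sym (+-suc (suc z) (L * x₁)))) (+-monoʳ-≤ (suc z) (s≤s (m≤n+m (L * x₁) e)))

  best-step-≡ : ∀ r z → suc z + r < n → Fits z (suc r) → best (suc z) r + N (suc z) r ≡ best z r
  best-step-≡ zero    z room _    = best-zero z (≤-trans (m≤m+n (suc z) 0) (<⇒≤ room))
  best-step-≡ (suc r) z room fits =
    trans (best-shift r z room) (cong (λ c → Φ e z (c ∷ greedy c r)) (sym (choice-shift z (suc r) fits)))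

  -- the largest value of Φ e p on admissible lists of length suc r starting with z
  Ψ : ℕ → ℕ → ℕ → ℕ
  Ψ p r z = ∑ p (z ∸ suc p) (λ b → N b (suc r)) + e * N z (suc r) + best z r

  Ψ-common : ℕ → ℕ → ℕ → ℕ
  Ψ-common p r z = ∑ p (z ∸ suc p) (λ b → N b (suc r)) + e * N (suc z) r + e * N (suc z) (suc r) + N (suc z) (suc r)

  module _ (p r z : ℕ) (p<z : p < z) (z<n : z < n) where

    private
      A = ∑ p (z ∸ suc p) (λ b → N b (suc r))
      P = N (suc z) r
      Q = N (suc z) (suc r)

    Ψ-suc : Ψ p r (suc z) + e * P ≡ Ψ-common p r z + (best (suc z) r + P)
    Ψ-suc rewrite +-∸-assoc 1 p<z | ∑-snoc p (z ∸ suc p) (λ b → N b (suc r)) | m+[n∸m]≡n p<z | N-pascal z r z<n =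
      regroup A P Q (best (suc z) r) e
      where
      regroup : ∀ A P Q V e → A + (P + Q) + e * Q + V + e * P ≡ A + e * P + e * Q + Q + (V + P)
      regroup = solve-∀

    Ψ-here : Ψ p r z + Q ≡ Ψ-common p r z + best z r
    Ψ-here rewrite N-pascal z r z<n = regroup A P Q (best z r) e
      where
      regroup : ∀ A P Q V e → A + e * (P + Q) + V + Q ≡ A + e * P + e * Q + Q + V
      regroup = solve-∀

  Ψ-step : ∀ p r z → GreedyIsMax r → p < z → suc z + r < n →
    Ψ p r (suc z) + e * N (suc z) r ≤ Ψ p r z + N (suc z) (suc r)
  Ψ-step p r z ih p<z room =
    subst₂ _≤_ (sym (Ψ-suc p r z p<z z<n)) (sym (Ψ-here p r z p<z z<n)) (+-monoʳ-≤ (Ψ-common p r z) (best-step r ih z room))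
    where z<n = ≤-trans (s≤s (m≤m+n z r)) (<⇒≤ room)

  Ψ-step-≡ : ∀ p r z → p < z → suc z + r < n → Fits z (suc r) →
    Ψ p r (suc z) + e * N (suc z) r ≡ Ψ p r z + N (suc z) (suc r)
  Ψ-step-≡ p r z p<z room fits =
    trans (Ψ-suc p r z p<z z<n) (trans (cong (Ψ-common p r z +_) (best-step-≡ r z room fits)) (sym (Ψ-here p r z p<z z<n)))
    where z<n = ≤-trans (s≤s (m≤m+n z r)) (<⇒≤ room)

  x₁-multiple : ∀ r → suc r * x₁ ≡ suc (suc r * e + r)
  x₁-multiple r = identity r e
    where
    identity : ∀ r e → suc r * suc e ≡ suc (suc r * e + r)
    identity = solve-∀

  Ψ-up : ∀ p r z → p < z → suc z + r < n → Fits z (suc r) → Ψ p r z < Ψ p r (suc z)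
  Ψ-up p r z p<z room fits = +-cancelʳ-< (e * N (suc z) r) _ _
    (subst (Ψ p r z + e * N (suc z) r <_) (sym (Ψ-step-≡ p r z p<z room fits))
           (+-monoʳ-< (Ψ p r z) (C-ratio.<-case (n ∸ suc z) r e T<M)))
    where
    T<M : suc r * e + r < n ∸ suc z
    T<M = m+n≤o⇒m≤o∸n (suc (suc r * e + r))
            (subst (_≤ n) (trans (cong (suc z +_) (x₁-multiple r)) (+-comm (suc z) _)) fits)

  Ψ-flat : ∀ p r z → GreedyIsMax r → p < z → suc z + r < n → z + suc r * x₁ ≡ n → Ψ p r (suc z) ≤ Ψ p r z
  Ψ-flat p r z ih p<z room exact = +-cancelʳ-≤ (e * N (suc z) r) _ _
    (subst (Ψ p r (suc z) + e * N (suc z) r ≤_) (cong (Ψ p r z +_) (sym (C-ratio.≡-case (n ∸ suc z) r e M≡T)))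
           (Ψ-step p r z ih p<z room))
    where
    M≡T : n ∸ suc z ≡ suc r * e + r
    M≡T = trans (cong (_∸ suc z) (trans (sym exact) (trans (cong (z +_) (x₁-multiple r)) (+-suc z _))))
                (m+n∸m≡n (suc z) _)

  Ψ-down : ∀ p r z → GreedyIsMax r → p < z → suc z + r < n → n < z + suc r * x₁ → Ψ p r (suc z) < Ψ p r z
  Ψ-down p r z ih p<z room over = +-cancelʳ-< (e * N (suc z) r) _ _
    (≤-<-trans (Ψ-step p r z ih p<z room) (+-monoʳ-< (Ψ p r z) (C-ratio.>-case (n ∸ suc z) r e M<T r≤M)))
    where
    z<n = ≤-trans (s≤s (m≤m+n z r)) (<⇒≤ room)
    n≤z+T : n ≤ z + (suc r * e + r)
    n≤z+T = ≤-pred (subst (n <_) (trans (cong (z +_) (x₁-multiple r)) (+-suc z _)) over)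
    M<T : n ∸ suc z < suc r * e + r
    M<T = subst (_≤ suc r * e + r) (+-∸-assoc 1 z<n)
            (subst (n ∸ z ≤_) (m+n∸m≡n z _) (∸-monoˡ-≤ z n≤z+T))
    r≤M : r ≤ n ∸ suc z
    r≤M = m+n≤o⇒m≤o∸n r (subst (_≤ n) (+-comm (suc z) r) (<⇒≤ room))

  strictly-below : {A : Set} {a b : ℕ} → a < b → a ≤ b × (b ≤ a → A)
  strictly-below a<b = <⇒≤ a<b , λ b≤a → ⊥-elim (<⇒≱ a<b b≤a)

  -- Ψ p r increases strictly up to q = n − (r + 1)·x₁, is flat for one step, and then decreases strictly.
  Ψ-max-fits : ∀ p r → GreedyIsMax r → Fits p (suc r) → ∀ z → p < z → z + r < n →
    let q = n ∸ suc r * x₁ in Ψ p r z ≤ Ψ p r q × (Ψ p r q ≤ Ψ p r z → Allowed p (suc r) z)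
  Ψ-max-fits p r ih fits z p<z z+r<n = by-position (<-cmp z q)
    where
    L  = suc r * x₁
    q  = n ∸ L
    G  = Ψ p r
    q+L≡n : q + L ≡ n
    q+L≡n = m∸n+n≡m (m+n≤o⇒n≤o (suc p) fits)
    p<q : p < q
    p<q = m+n≤o⇒m≤o∸n (suc p) fits
    below-z : ∀ y → y < z → suc y + r < n
    below-z y y<z = ≤-<-trans (+-monoˡ-≤ r y<z) z+r<n
    by-position : Tri (z < q) (z ≡ q) (q < z) → G z ≤ G q × (G q ≤ G z → Allowed p (suc r) z)
    by-position (tri< z<q _ _) = strictly-below (<-chain G up z<q)
      where
      up : ∀ y → z ≤ y → y < q → G y < G (suc y)
      up y z≤y y<q = Ψ-up p r y (<-≤-trans p<z z≤y)
        (≤-<-trans (+-monoˡ-≤ r y<q) (subst (q + r <_) q+L≡n (+-monoʳ-< q (L≤L*x₁ (suc r)))))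
        (subst (suc y + L ≤_) q+L≡n (+-monoˡ-≤ L y<q))
    by-position (tri≈ _ refl _) = ≤-refl , λ _ → inj₁ (fits , inj₁ q+L≡n)
    by-position (tri> _ _ q<z) with m≤n⇒m<n∨m≡n q<z
    ... | inj₂ refl = Ψ-flat p r q ih p<q (below-z q q<z) q+L≡n , λ _ → inj₁ (fits , inj₂ (cong suc q+L≡n))
    ... | inj₁ q+1<z = strictly-below (<-≤-trans (>-chain G down q+1<z) (Ψ-flat p r q ih p<q (below-z q q<z) q+L≡n))
      where
      down : ∀ y → suc q ≤ y → y < z → G (suc y) < G y
      down y q<y y<z = Ψ-down p r y ih (<-trans p<q q<y) (below-z y y<z)
        (≤-<-trans (≤-reflexive (sym q+L≡n)) (+-monoˡ-< L q<y))

  Ψ-max-¬fits : ∀ p r → GreedyIsMax r → ¬ Fits p (suc r) → ∀ z → p < z → z + r < n →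
    Ψ p r z ≤ Ψ p r (suc p) × (Ψ p r (suc p) ≤ Ψ p r z → Allowed p (suc r) z)
  Ψ-max-¬fits p r ih ¬fits z p<z z+r<n with m≤n⇒m<n∨m≡n p<z
  ... | inj₂ refl  = ≤-refl , λ _ → inj₂ (¬fits , refl)
  ... | inj₁ p+1<z = strictly-below (>-chain (Ψ p r) down p+1<z)
    where
    down : ∀ y → suc p ≤ y → y < z → Ψ p r (suc y) < Ψ p r y
    down y p<y y<z = Ψ-down p r y ih p<y (≤-<-trans (+-monoˡ-≤ r y<z) z+r<n)
      (<-≤-trans (≰⇒> ¬fits) (+-monoˡ-≤ (suc r * x₁) p<y))

  Ψ-max-at-choice : ∀ p r → GreedyIsMax r → ∀ z → p < z → z + r < n →
    Ψ p r z ≤ Ψ p r (choice p (suc r)) × (Ψ p r (choice p (suc r)) ≤ Ψ p r z → Allowed p (suc r) z)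
  Ψ-max-at-choice p r ih z p<z z+r<n with choice-spec p (suc r)
  ... | inj₁ (fits , eq)  rewrite eq = Ψ-max-fits p r ih fits z p<z z+r<n
  ... | inj₂ (¬fits , eq) rewrite eq = Ψ-max-¬fits p r ih ¬fits z p<z z+r<n

  greedy-optimal : ∀ r → GreedyIsMax r × MaxIsGreedy r
  greedy-optimal zero = (λ { p [] _ _ → ≤-refl }) , (λ { p [] _ _ _ → tt })
  greedy-optimal (suc r) with greedy-optimal r
  ... | ih-max , ih-greedy = is-max , is-greedy
    where
    best≡Ψ : ∀ p → best p (suc r) ≡ Ψ p r (choice p (suc r))
    best≡Ψ p = Φ-∷ p (choice p (suc r)) (greedy (choice p (suc r)) r) r (length-greedy _ r)
    Φ≤Ψ : ∀ p z Z → length Z ≡ r → Admissible z Z → Φ e p (z ∷ Z) ≤ Ψ p r z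
    Φ≤Ψ p z Z len adm rewrite Φ-∷ p z Z r len = +-monoʳ-≤ _ (ih-max z Z len adm)
    tail-room : ∀ z Z → length Z ≡ r → z < n → Admissible z Z → z + r < n
    tail-room z Z len z<n adm = subst (λ l → z + l < n) len (admissible-room z Z z<n adm)
    is-max : GreedyIsMax (suc r)
    is-max p (z ∷ Z) len ((p<z , asc) , z<n ∷ Z<n) = begin
      Φ e p (z ∷ Z)               ≤⟨ Φ≤Ψ p z Z len′ (asc , Z<n) ⟩
      Ψ p r z                     ≤⟨ proj₁ (Ψ-max-at-choice p r ih-max z p<z z+r<n) ⟩
      Ψ p r (choice p (suc r))    ≡⟨ sym (best≡Ψ p) ⟩
      best p (suc r)              ∎
      where
      open ≤-Reasoning
      len′  = suc-injective len
      z+r<n = tail-room z Z len′ z<n (asc , Z<n)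
    is-greedy : MaxIsGreedy (suc r)
    is-greedy p (z ∷ Z) len ((p<z , asc) , z<n ∷ Z<n) best≤Φ =
      subst (λ l → Allowed p (suc l) z) (sym len′)
            (proj₂ at-z (≤-trans Ψc≤Φ (Φ≤Ψ p z Z len′ (asc , Z<n)))) ,
      ih-greedy z Z len′ (asc , Z<n) (+-cancelˡ-≤ head _ _ (≤-trans (proj₁ at-z) Ψc≤head+Φ))
      where
      len′  = suc-injective len
      z+r<n = tail-room z Z len′ z<n (asc , Z<n)
      at-z  = Ψ-max-at-choice p r ih-max z p<z z+r<n
      head  = ∑ p (z ∸ suc p) (λ b → N b (suc r)) + e * N z (suc r)
      Ψc≤Φ : Ψ p r (choice p (suc r)) ≤ Φ e p (z ∷ Z)
      Ψc≤Φ = subst (_≤ Φ e p (z ∷ Z)) (best≡Ψ p) best≤Φ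
      Ψc≤head+Φ : Ψ p r (choice p (suc r)) ≤ head + Φ e z Z
      Ψc≤head+Φ = subst (Ψ p r (choice p (suc r)) ≤_) (Φ-∷ p z Z r len′) Ψc≤Φ

  on-top-bound : ∀ {m} → m ≡ n ⊎ m ≡ suc n → m ≤ suc n
  on-top-bound (inj₁ refl) = n≤1+n n
  on-top-bound (inj₂ refl) = ≤-refl

  top-or-bottom : ∀ b c v → b + c ≤ suc n → Placed b c v → v + c ≡ n ⊎ v + c ≡ suc n
  top-or-bottom b c v _    (inj₁ (_ , top))      = top
  top-or-bottom b c v room (inj₂ (¬fits , refl)) = inj₂ (≤-antisym room (≰⇒> ¬fits))

  Greedy⇒Placed : ∀ p Z → Greedy p Z → ∀ l → 1 ≤ l → l ≤ length Z →
    Placed (l + p) (suc (length Z ∸ l) * x₁) (elemAt Z l)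
  Greedy⇒Placed p (z ∷ Z) (allowed , _) (suc zero) _ _ = allowed
  Greedy⇒Placed p (z ∷ Z) (allowed , greedy) (suc (suc l)) _ (s≤s l<) =
    after allowed (Greedy⇒Placed z Z greedy (suc l) (s≤s z≤n) l<)
    where
    c = suc (length Z ∸ suc l) * x₁
    L = suc (length Z) * x₁
    c+l≤L : c + suc l ≤ L
    c+l≤L = begin
      c + suc l                             ≤⟨ +-monoʳ-≤ c (L≤L*x₁ (suc l)) ⟩
      c + suc l * x₁                        ≡⟨ sym (*-distribʳ-+ x₁ (suc (length Z ∸ suc l)) (suc l)) ⟩
      (suc (length Z ∸ suc l) + suc l) * x₁ ≡⟨ cong (λ m → suc m * x₁) (m∸n+n≡m l<) ⟩
      L                                     ∎
      where open ≤-Reasoning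
    shift : ∀ m → suc l + m + c ≤ m + L
    shift m = subst (_≤ m + L) (regroup (suc l) m c) (+-monoʳ-≤ m c+l≤L)
      where
      regroup : ∀ a m c → m + (c + a) ≡ a + m + c
      regroup = solve-∀
    after : Allowed p (suc (length Z)) z → Placed (suc l + z) c (elemAt Z (suc l)) →
      Placed (suc (suc l) + p) c (elemAt Z (suc l))
    after (inj₂ (_ , refl)) placed = subst (λ b → Placed b c (elemAt Z (suc l))) (+-suc (suc l) p) placed
    after (inj₁ (fits , top)) placed =
      inj₁ (≤-trans (≤-reflexive (cong (_+ c) (sym (+-suc (suc l) p)))) (≤-trans (shift (suc p)) fits) ,
            top-or-bottom (suc l + z) c _ (≤-trans (shift z) (on-top-bound top)) placed)

  Placed⇒dichotomy : ∀ b c v → Placed b c v →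
    (b + c ≤ suc n → v + c ≡ n ⊎ v + c ≡ suc n) × (¬ (b + c ≤ suc n) → v ≡ b)
  Placed⇒dichotomy b c v (inj₁ (fits , top))        = (λ _ → top) , (λ ¬room → ⊥-elim (¬room (m≤n⇒m≤1+n fits)))
  Placed⇒dichotomy b c v placed@(inj₂ (_ , v≡b))     = (λ room → top-or-bottom b c v room placed) , (λ _ → v≡b)

  greedy-element : ∀ r X′ → length X′ ≡ r → Greedy (suc e) X′ → ∀ l → suc l ≤ r →
    let b = suc l + suc e; c = (r ∸ l) * suc e; v = elemAt X′ (suc l) in
    (b + c ≤ suc n → v + c ≡ n ⊎ v + c ≡ suc n) × (¬ (b + c ≤ suc n) → v ≡ b)
  greedy-element r X′ refl greedy l l<r rewrite +-∸-assoc 1 l<r =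
    Placed⇒dichotomy _ _ _ (Greedy⇒Placed (suc e) X′ greedy (suc l) (s≤s z≤n) l<r)

module Maximisers where

  open import Data.Nat
  open import Data.Nat.Properties
  open Subsets

  <-∉ : ∀ {n} Y → All (_< n) Y → n ∉ Y
  <-∉ Y Y<n n∈Y = <-irrefl refl (All.lookup Y<n n∈Y)

  ≤-∉⇒< : ∀ {n} Y → All (_≤ n) Y → n ∉ Y → All (_< n) Y
  ≤-∉⇒< Y Y≤n n∉Y = All.tabulate (λ {y} y∈Y → ≤∧≢⇒< (All.lookup Y≤n y∈Y) (λ { refl → n∉Y y∈Y }))

  ∈-subsets-∉⇒ : ∀ n r X → X ∈ subsets n r → n ∉ X → length X ≡ r × Ascending 0 X × All (_< n) X
  ∈-subsets-∉⇒ n r X X∈ n∉X with ∈-subsets⁻ n r X X∈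
  ... | len , asc , X≤n = len , asc , ≤-∉⇒< X X≤n n∉X

  module _ (n e : ℕ) where
    open Decomposition n
    open Maximisation n e

    maximiser⇒greedy : ∀ r X′ → length X′ ≡ r → Admissible (suc e) X′ → suc e < n →
      ((Y : List ℕ) → Y ∈ subsets n (suc r) → n ∉ Y → elemAt Y 1 ≡ suc e →
        cardV n (suc (suc r)) Y ≤ cardV n (suc (suc r)) (suc e ∷ X′)) →
      Greedy (suc e) X′
    maximiser⇒greedy r X′ len adm@(asc , X′<n) x₁<n max =
      proj₂ (greedy-optimal r) (suc e) X′ len adm (+-cancelˡ-≤ (e * N (suc e) (suc r)) _ _ card≤)
      where
      room : suc e + r < n
      room = subst (λ l → suc e + l < n) len (admissible-room (suc e) X′ x₁<n adm)
      G = greedy (suc e) r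
      G-adm = greedy-admissible r (suc e) room
      Y<n : All (_< n) (suc e ∷ G)
      Y<n = x₁<n ∷ proj₂ G-adm
      Y∈ : suc e ∷ G ∈ subsets n (suc r)
      Y∈ = subst (λ l → suc e ∷ G ∈ subsets n (suc l)) (length-greedy (suc e) r)
             (∈-subsets⁺ n (suc e ∷ G) (z<s , proj₁ G-adm) (All.map <⇒≤ Y<n))
      card≤ : e * N (suc e) (suc r) + Φ e (suc e) G ≤ e * N (suc e) (suc r) + Φ e (suc e) X′
      card≤ = subst₂ _≤_
        (cardV-decomposition e r G (length-greedy (suc e) r) (proj₁ G-adm) (<⇒≤ x₁<n) (All.map <⇒≤ (proj₂ G-adm)))
        (cardV-decomposition e r X′ len asc (<⇒≤ x₁<n) (All.map <⇒≤ X′<n))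
        (max (suc e ∷ G) Y∈ (<-∉ (suc e ∷ G) Y<n) refl)

module IntegerForm where

  open import Data.Nat as ℕ using (suc)
  open import Data.Integer using (+_; _+_; _-_; -_; _*_; _≤_; +≤+)
  open import Data.Integer.Properties using (pos-+; pos-*; +-monoˡ-≤; drop‿+≤+)
  open import Data.Integer.Tactic.RingSolver using (solve-∀)

  pos-∸ : ∀ v c t → v ℕ.+ c ≡ t → + v ≡ + t - + c
  pos-∸ v c t refl = sym (trans (cong (_- + c) (pos-+ v c)) (cancel (+ v) (+ c)))
    where
    cancel : ∀ a b → a + b - b ≡ a
    cancel = solve-∀

  ≤-minus⇒ : ∀ a b c → + a ≤ + b - + c → a ℕ.+ c ℕ.≤ b
  ≤-minus⇒ a b c h = drop‿+≤+ (subst₂ _≤_ (sym (pos-+ a c)) (cancel (+ b) (+ c)) (+-monoˡ-≤ (+ c) h))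
    where
    cancel : ∀ b c → b - c + c ≡ b
    cancel = solve-∀

  ≤-minus⇐ : ∀ a b c → a ℕ.+ c ℕ.≤ b → + a ≤ + b - + c
  ≤-minus⇐ a b c h = subst (_≤ + b - + c) (sym (pos-∸ a c (a ℕ.+ c) refl)) (+-monoˡ-≤ (- + c) (+≤+ h))

  index≡ : ∀ x m → + x + + suc m - + 1 ≡ + (m ℕ.+ x)
  index≡ x m = trans (cong (λ t → + x + t - + 1) (pos-+ 1 m)) (trans (shuffle (+ x) (+ m) (+ 1)) (sym (pos-+ m x)))
    where
    shuffle : ∀ x m o → x + (o + m) - o ≡ m + x
    shuffle = solve-∀

  top≡ : ∀ n K x → + n - + K * + x + + 1 ≡ + suc n - + (K ℕ.* x)
  top≡ n K x = trans (cong (λ t → + n - t + + 1) (sym (pos-* K x)))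
                     (trans (shuffle (+ n) (+ (K ℕ.* x)) (+ 1)) (cong (_- + (K ℕ.* x)) (sym (pos-+ 1 n))))
    where
    shuffle : ∀ n c o → n - c + o ≡ o + n - c
    shuffle = solve-∀

  dichotomy-ℤ : ∀ n x m K v →
    (((m ℕ.+ x) ℕ.+ K ℕ.* x ℕ.≤ suc n → (v ℕ.+ K ℕ.* x ≡ n ⊎ v ℕ.+ K ℕ.* x ≡ suc n))
      × (¬ ((m ℕ.+ x) ℕ.+ K ℕ.* x ℕ.≤ suc n) → v ≡ m ℕ.+ x)) →
    ((+ x + + suc m - + 1 ≤ + n - + K * + x + + 1 →
        (+ v ≡ + n - + K * + x ⊎ + v ≡ + n - + K * + x + + 1))
     × (¬ (+ x + + suc m - + 1 ≤ + n - + K * + x + + 1) → + v ≡ + x + + suc m - + 1))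
  dichotomy-ℤ n x m K v (at-top , at-bottom) = at-top′ , at-bottom′
    where
    c = K ℕ.* x
    to-ℕ : + x + + suc m - + 1 ≤ + n - + K * + x + + 1 → (m ℕ.+ x) ℕ.+ c ℕ.≤ suc n
    to-ℕ h = ≤-minus⇒ (m ℕ.+ x) (suc n) c (subst₂ _≤_ (index≡ x m) (top≡ n K x) h)
    from-ℕ : (m ℕ.+ x) ℕ.+ c ℕ.≤ suc n → + x + + suc m - + 1 ≤ + n - + K * + x + + 1
    from-ℕ h = subst₂ _≤_ (sym (index≡ x m)) (sym (top≡ n K x)) (≤-minus⇐ (m ℕ.+ x) (suc n) c h)
    at-top′ : + x + + suc m - + 1 ≤ + n - + K * + x + + 1 → (+ v ≡ + n - + K * + x ⊎ + v ≡ + n - + K * + x + + 1)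
    at-top′ h with at-top (to-ℕ h)
    ... | inj₁ v+c≡n  = inj₁ (trans (pos-∸ v c n v+c≡n) (cong (λ t → + n - t) (pos-* K x)))
    ... | inj₂ v+c≡n+1 = inj₂ (trans (pos-∸ v c (suc n) v+c≡n+1) (sym (top≡ n K x)))
    at-bottom′ : ¬ (+ x + + suc m - + 1 ≤ + n - + K * + x + + 1) → + v ≡ + x + + suc m - + 1
    at-bottom′ ¬h = trans (cong +_ (at-bottom (λ h → ¬h (from-ℕ h)))) (sym (index≡ x m))

open import Data.Nat using (ℕ; _≤_; _∸_; zero; suc; s≤s)
open import Data.Nat.Properties using (suc-injective)
open import Data.Integer using (ℤ; +_; _+_; _-_; _*_) renaming (_≤_ to _≤ℤ_)
open Maximisation using (greedy-element)
open Maximisers using (∈-subsets-∉⇒; maximiser⇒greedy)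
open IntegerForm using (dichotomy-ℤ)

mainTheorem11 : (n k : ℕ) → 2 ≤ k → k ≤ n ∸ 1 →
    (X : List ℕ) → X ∈ subsets n (k ∸ 1) → n ∉ X →
    ((Y : List ℕ) → Y ∈ subsets n (k ∸ 1) → n ∉ Y → elemAt Y 1 ≡ elemAt X 1 →
      cardV n k Y ≤ cardV n k X) →
    (i : ℕ) → 2 ≤ i → i ≤ k ∸ 1 →
      ((+ elemAt X 1 + + i - + 1 ≤ℤ + n - + (k ∸ i) * + elemAt X 1 + + 1 →
          (+ elemAt X i ≡ + n - + (k ∸ i) * + elemAt X 1
            ⊎ + elemAt X i ≡ + n - + (k ∸ i) * + elemAt X 1 + + 1))
       × (¬ (+ elemAt X 1 + + i - + 1 ≤ℤ + n - + (k ∸ i) * + elemAt X 1 + + 1) →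
          + elemAt X i ≡ + elemAt X 1 + + i - + 1))
mainTheorem11 n zero          () _
mainTheorem11 n (suc zero)    (s≤s ()) _
mainTheorem11 n (suc (suc r)) _ _ X X∈ n∉X max zero          () _
mainTheorem11 n (suc (suc r)) _ _ X X∈ n∉X max (suc zero)    (s≤s ()) _
mainTheorem11 n (suc (suc r)) _ _ X X∈ n∉X max (suc (suc l)) _ (s≤s l<r)
  with X | ∈-subsets-∉⇒ n (suc r) X X∈ n∉X
... | []         | () , _ , _
... | zero  ∷ _  | _ , (() , _) , _
... | suc e ∷ X′ | len , (_ , asc) , x₁<n ∷ X′<n =
  dichotomy-ℤ n (suc e) (suc l) (r ∸ l) (elemAt X′ (suc l))
    (greedy-element n e r X′ (suc-injective len)
      (maximiser⇒greedy n e r X′ (suc-injective len) (asc , X′<n) x₁<n max) l l<r)
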